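{- Fix $P,Q\in\mathbb{Z}$. If $R_1,R_2,\ldots,R_n\in\mathbb{Q}$, then there exists $R\in\mathbb{Q}$ such that $\bigcap_{i=1}^n \mathcal{L}(P,Q,R_i)=\mathcal{L}(P,Q,R)$.
   Context: $\mathbb{N}=\{0,1,2,\ldots\}$. For $P,Q\in\mathbb{Z}$, the Lucas sequence $U_n=U_n(P,Q)$ is defined by $U_0=0$, $U_1=1$, $U_{n+2}=PU_{n+1}-QU_n$. For $R\in\mathbb{Q}$, $\mathcal{L}(P,Q,R)=\{n\in\mathbb{N} : U_nR\in\mathbb{Z}\}$. -}

module Defs where

open import Data.Nat using (ℕ; zero; suc)
open import Data.Integer using (ℤ; +_; _-_; _*_)
open import Data.Rational using (ℚ; _/_) renaming (_*_ to _*ℚ_)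
open import Data.Rational as ℚ using ()
open import Data.Product using (∃)
open import Relation.Binary.PropositionalEquality using (_≡_)

U : ℤ → ℤ → ℕ → ℤ
U P Q zero = + 0
U P Q (suc zero) = + 1
U P Q (suc (suc n)) = P * U P Q (suc n) - Q * U P Q n

-- n ∈ L(P,Q,R)  iff  U_n R ∈ ℤ (i.e. U_n · R equals some integer, as rationals)
InL : ℤ → ℤ → ℚ → ℕ → Set
InL P Q R n = ∃ λ (z : ℤ) → ℚ._*_ (ℚ._/_ (U P Q n) 1) R ≡ ℚ._/_ z 1

module Submission where

-- Since the numerator and denominator of a rational q are coprime, an integer
-- multiple u q is integral exactly when the denominator of q divides u.  Hence
-- n lies in every L(P,Q,R_i) iff every denominator of R_i divides U_n, iff their
-- lcm L divides U_n, iff n ∈ L(P,Q,1/L).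

open import Defs
open import Data.Fin using (Fin; zero; suc)
open import Data.Nat as ℕ using (ℕ; NonZero; ≢-nonZero; ≢-nonZero⁻¹)
import Data.Nat.Properties as ℕ
open import Data.Nat.Coprimality using (1-coprimeTo; recompute)
import Data.Nat.Coprimality as Coprimality
open import Data.Nat.Divisibility using (_∣_; 1∣_; ∣-trans; m∣m*n; n∣m*n; 0∣⇒≡0)
open import Data.Nat.LCM using (lcm; m∣lcm[m,n]; n∣lcm[m,n]; lcm-least)
open import Data.Integer as ℤ using (ℤ; +_)
import Data.Integer.Properties as ℤ
import Data.Integer.Coprimality as ℤ
import Data.Integer.Divisibility as ℤ
open import Data.Integer.Divisibility.Signed as Signed using (divides; ∣ᵤ⇒∣; ∣⇒∣ᵤ)
open import Data.Rational as ℚ using (ℚ; mkℚ; ↥_; ↧_; ↧ₙ_; _/_; toℚᵘ)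
open import Data.Rational.Properties using (↥p/↧p≡p; normalize-coprime; toℚᵘ-injective; toℚᵘ-homo-*)
open import Data.Rational.Unnormalised as ℚᵘ using (mkℚᵘ; *≡*) renaming (↥_ to ↥ᵘ_; ↧_ to ↧ᵘ_)
import Data.Rational.Unnormalised.Properties as ℚᵘ
open import Data.Product using (∃; _×_; _,_)
open import Function.Base using (_∘_)
open import Function.Bundles using (_⇔_; mk⇔; Equivalence)
open import Function.Properties.Equivalence using (⇔-setoid)
open import Function.Construct.Symmetry using (⇔-sym)
open import Level using (0ℓ)
open import Relation.Binary.PropositionalEquality using (_≡_; sym; trans; cong; subst)
open Equivalence using (to; from)

∀-cong-⇔ : {A : Set} {B C : A → Set} → (∀ x → B x ⇔ C x) → (∀ x → B x) ⇔ (∀ x → C x)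
∀-cong-⇔ B⇔C = mk⇔ (λ b x → to (B⇔C x) (b x)) (λ c x → from (B⇔C x) (c x))

integer : ℤ → ℚ
integer z = mkℚ z 0 (Coprimality.sym (1-coprimeTo ℤ.∣ z ∣))

IsInteger : ℚ → Set
IsInteger p = ∃ λ z → p ≡ z / 1

z/1≡integer : ∀ z → z / 1 ≡ integer z
z/1≡integer z = ↥p/↧p≡p (integer z)

-- The denominator of mkℚᵘ u 0 ℚᵘ.* mkℚᵘ n d computes to suc (d + 0).
integerᵘ-*-≃-integerᵘ⇔ : ∀ u p z → mkℚᵘ u 0 ℚᵘ.* p ℚᵘ.≃ mkℚᵘ z 0 ⇔ u ℤ.* ↥ᵘ p ≡ z ℤ.* ↧ᵘ p
integerᵘ-*-≃-integerᵘ⇔ u (mkℚᵘ n d) z = mk⇔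
  (λ { (*≡* e) → trans (sym (ℤ.*-identityʳ _)) (trans e (cong (λ k → z ℤ.* + ℕ.suc k) (ℕ.+-identityʳ d))) })
  (λ e → *≡* (trans (ℤ.*-identityʳ _) (trans e (cong (λ k → z ℤ.* + ℕ.suc k) (sym (ℕ.+-identityʳ d))))))

integer-*-≡-integer⇔ : ∀ u q z → u / 1 ℚ.* q ≡ z / 1 ⇔ u ℤ.* ↥ q ≡ z ℤ.* ↧ q
integer-*-≡-integer⇔ u q@record{} z rewrite z/1≡integer u | z/1≡integer z = mk⇔
  (λ e → to (integerᵘ-*-≃-integerᵘ⇔ u (toℚᵘ q) z)
           (ℚᵘ.≃-trans (ℚᵘ.≃-sym (toℚᵘ-homo-* (integer u) q)) (ℚᵘ.≃-reflexive (cong toℚᵘ e))))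
  (λ e → toℚᵘ-injective
           (ℚᵘ.≃-trans (toℚᵘ-homo-* (integer u) q) (from (integerᵘ-*-≃-integerᵘ⇔ u (toℚᵘ q) z) e)))

↧-coprime-↥ : ∀ q → ℤ.Coprime (↧ q) (↥ q)
↧-coprime-↥ (mkℚ _ _ ↥⊥↧) = Coprimality.sym (recompute ↥⊥↧)

coprime⇒∣*⇔∣ : ∀ {d n} u → ℤ.Coprime d n → d ℤ.∣ u ℤ.* n ⇔ d ℤ.∣ u
coprime⇒∣*⇔∣ {d} {n} u d⊥n = mk⇔
  (λ d∣un → ℤ.coprime-divisor d n u d⊥n (subst (d ℤ.∣_) (ℤ.*-comm u n) d∣un))
  (λ d∣u → ∣⇒∣ᵤ {d} {u ℤ.* n} (Signed.∣m⇒∣m*n n (∣ᵤ⇒∣ {d} {u} d∣u)))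

isInteger-integer-*⇔↧∣ : ∀ u q → IsInteger (u / 1 ℚ.* q) ⇔ ↧ q ℤ.∣ u
isInteger-integer-*⇔↧∣ u q = mk⇔
  (λ (z , e) → to ↧∣u*↥⇔↧∣u (∣⇒∣ᵤ {↧ q} (divides z (to (integer-*-≡-integer⇔ u q z) e))))
  (λ ↧∣u → let divides z e = ∣ᵤ⇒∣ {↧ q} {u ℤ.* ↥ q} (from ↧∣u*↥⇔↧∣u ↧∣u) in z , from (integer-*-≡-integer⇔ u q z) e)
  where
  ↧∣u*↥⇔↧∣u : ↧ q ℤ.∣ u ℤ.* ↥ q ⇔ ↧ q ℤ.∣ u
  ↧∣u*↥⇔↧∣u = coprime⇒∣*⇔∣ {↧ q} {↥ q} u (↧-coprime-↥ q)

↧ₙ[1/d]≡d : ∀ d .{{_ : NonZero d}} → ↧ₙ (+ 1 / d) ≡ d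
↧ₙ[1/d]≡d (ℕ.suc d-1) = cong ↧ₙ_ (normalize-coprime (1-coprimeTo (ℕ.suc d-1)))

lcm-nonZero : ∀ m n .{{_ : NonZero m}} .{{_ : NonZero n}} → NonZero (lcm m n)
lcm-nonZero m n = ≢-nonZero λ lcm≡0 →
  ≢-nonZero⁻¹ (m ℕ.* n) {{ℕ.m*n≢0 m n}}
    (0∣⇒≡0 (subst (_∣ m ℕ.* n) lcm≡0 (lcm-least {m} {n} (m∣m*n n) (n∣m*n m))))

lcmᶠ : ∀ {n} → (Fin n → ℕ) → ℕ
lcmᶠ {ℕ.zero}  f = 1
lcmᶠ {ℕ.suc n} f = lcm (f zero) (lcmᶠ (f ∘ suc))

lcmᶠ-nonZero : ∀ {n} (f : Fin n → ℕ) → (∀ i → NonZero (f i)) → NonZero (lcmᶠ f)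
lcmᶠ-nonZero {ℕ.zero}  f f≢0 = _
lcmᶠ-nonZero {ℕ.suc n} f f≢0 =
  lcm-nonZero (f zero) (lcmᶠ (f ∘ suc)) {{f≢0 zero}} {{lcmᶠ-nonZero (f ∘ suc) (f≢0 ∘ suc)}}

lcmᶠ∣⇔ : ∀ {n} (f : Fin n → ℕ) {m} → lcmᶠ f ∣ m ⇔ (∀ i → f i ∣ m)
lcmᶠ∣⇔ {ℕ.zero}  f {m} = mk⇔ (λ _ ()) (λ _ → 1∣ m)
lcmᶠ∣⇔ {ℕ.suc n} f     = mk⇔
  (λ { lcm∣m zero    → ∣-trans (m∣lcm[m,n] (f zero) (lcmᶠ (f ∘ suc))) lcm∣m
     ; lcm∣m (suc i) → to (lcmᶠ∣⇔ (f ∘ suc)) (∣-trans (n∣lcm[m,n] (f zero) (lcmᶠ (f ∘ suc))) lcm∣m) i })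
  (λ f∣m → lcm-least (f∣m zero) (from (lcmᶠ∣⇔ (f ∘ suc)) (f∣m ∘ suc)))

lemma2p2 : (P Q : ℤ) (n : ℕ) (Rs : Fin n → ℚ) →
    ∃ λ (R : ℚ) → ∀ (m : ℕ) →
      ((∀ (i : Fin n) → InL P Q (Rs i) m) → InL P Q R m) ×
      (InL P Q R m → ∀ (i : Fin n) → InL P Q (Rs i) m)
lemma2p2 P Q n Rs = + 1 / L , λ m → let R⇔Rs = InL-R⇔InL-Rs m in from R⇔Rs , to R⇔Rs
  where
  L : ℕ
  L = lcmᶠ (↧ₙ_ ∘ Rs)
  instance
    L≢0 : NonZero L
    L≢0 = lcmᶠ-nonZero (↧ₙ_ ∘ Rs) (λ i → _)
  InL-R⇔InL-Rs : ∀ m → InL P Q (+ 1 / L) m ⇔ (∀ i → InL P Q (Rs i) m)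
  InL-R⇔InL-Rs m = begin
    InL P Q (+ 1 / L) m                ≈⟨ isInteger-integer-*⇔↧∣ (U P Q m) (+ 1 / L) ⟩
    ↧ₙ (+ 1 / L) ∣ ℤ.∣ U P Q m ∣       ≡⟨ cong (_∣ ℤ.∣ U P Q m ∣) (↧ₙ[1/d]≡d L) ⟩
    L ∣ ℤ.∣ U P Q m ∣                  ≈⟨ lcmᶠ∣⇔ (↧ₙ_ ∘ Rs) ⟩
    (∀ i → ↧ₙ (Rs i) ∣ ℤ.∣ U P Q m ∣)  ≈⟨ ∀-cong-⇔ (λ i → ⇔-sym (isInteger-integer-*⇔↧∣ (U P Q m) (Rs i))) ⟩
    (∀ i → InL P Q (Rs i) m)           ∎
    where open import Relation.Binary.Reasoning.Setoid (⇔-setoid 0ℓ)
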